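{- Suppose that propositional truncations do not increase universe levels (\(\|X\|:\mathcal U\) whenever \(X:\mathcal U\)). (i) If \(\Omega_{\mathcal V}\) is \(\mathcal U\)-small for universes \(\mathcal U,\mathcal V\), then the set quotient \(X/{\approx}\) is \(\mathcal U\)-small for any type \(X:\mathcal U\) and any \(\mathcal V\)-valued equivalence relation \(\approx\) on \(X\). (ii) Conversely, if the set quotient \(\mathbf 2/{\approx}\) is \(\mathcal U_0\)-small for every \(\mathcal V\)-valued equivalence relation \(\approx\) on the two-element type \(\mathbf 2:\mathcal U_0\), then every proposition \(P:\mathcal V\) is \(\mathcal U_0\)-small.
   Context: Work in intensional Martin-Löf type theory with universes (\(\mathcal U_0\) the first), function and propositional extensionality, and propositional truncations \(\|-\|\) with elimination into propositions of any universe; \(\exists_{x:X}Y(x):=\|\Sigma_{x:X}Y(x)\|\). A type is \(\mathcal W\)-small if equivalent to a type in \(\mathcal W\). \(\Omega_{\mathcal V}\) is the type of propositions in \(\mathcal V\). An equivalence relation \(\approx:X\to X\to\mathcal V\) is proposition-valued, reflexive, symmetric, transitive. The set quotient is defined as \(X/{\approx}:=\Sigma_{A:X\to\Omega_{\mathcal V}}\exists_{x:X}(e_\approx(x)=A)\), the image of \(e_\approx:X\to(X\to\Omega_{\mathcal V})\), \(e_\approx(x)=(y\mapsto(x\approx y))\). -}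

{-# OPTIONS --without-K --safe #-}
module Defs where

open import Level using (Level; _⊔_; suc; zero; Setω)
open import Data.Product using (Σ; _×_; _,_; proj₁; proj₂)
open import Relation.Binary.PropositionalEquality using (_≡_)

private variable 𝓤 𝓥 𝓦 : Level

isProp : Set 𝓤 → Set 𝓤
isProp X = (x y : X) → x ≡ y

isEquiv : {X : Set 𝓤} {Y : Set 𝓥} → (X → Y) → Set (𝓤 ⊔ 𝓥)
isEquiv {X = X} {Y} f =
  (Σ (Y → X) λ g → (y : Y) → f (g y) ≡ y) × (Σ (Y → X) λ h → (x : X) → h (f x) ≡ x)

_≃_ : Set 𝓤 → Set 𝓥 → Set (𝓤 ⊔ 𝓥)
X ≃ Y = Σ (X → Y) isEquiv

_is_small : Set 𝓤 → (𝓦 : Level) → Set (𝓤 ⊔ suc 𝓦)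
X is 𝓦 small = Σ (Set 𝓦) λ Y → Y ≃ X

FunExt : Setω
FunExt = ∀ {𝓤 𝓥} {A : Set 𝓤} {B : A → Set 𝓥} {f g : (x : A) → B x}
       → ((x : A) → f x ≡ g x) → f ≡ g

PropExt : Setω
PropExt = ∀ {𝓤} {P Q : Set 𝓤} → isProp P → isProp Q → (P → Q) → (Q → P) → P ≡ Q

record PropTrunc : Setω where
  field
    ∥_∥      : Set 𝓤 → Set 𝓤
    ∥∥-isProp : {X : Set 𝓤} → isProp ∥ X ∥
    ∣_∣      : {X : Set 𝓤} → X → ∥ X ∥
    ∥∥-rec   : {X : Set 𝓤} {P : Set 𝓥} → isProp P → (X → P) → ∥ X ∥ → P

Ω : (𝓥 : Level) → Set (suc 𝓥)
Ω 𝓥 = Σ (Set 𝓥) isProp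

record EqRel {𝓤} (X : Set 𝓤) (𝓥 : Level) : Set (𝓤 ⊔ suc 𝓥) where
  field
    _≈_     : X → X → Set 𝓥
    ≈-prop  : (x y : X) → isProp (x ≈ y)
    ≈-refl  : (x : X) → x ≈ x
    ≈-sym   : (x y : X) → x ≈ y → y ≈ x
    ≈-trans : (x y z : X) → x ≈ y → y ≈ z → x ≈ z

eqClass : {X : Set 𝓤} (R : EqRel X 𝓥) → X → (X → Ω 𝓥)
eqClass R x y = (EqRel._≈_ R x y , EqRel.≈-prop R x y)

∃∥ : PropTrunc → {X : Set 𝓤} → (X → Set 𝓥) → Set (𝓤 ⊔ 𝓥)
∃∥ pt {X} Y = PropTrunc.∥_∥ pt (Σ X Y)

_/[_]_ : (X : Set 𝓤) → PropTrunc → EqRel X 𝓥 → Set (𝓤 ⊔ suc 𝓥)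
_/[_]_ {𝓥 = 𝓥} X pt R = Σ (X → Ω 𝓥) λ A → ∃∥ pt (λ x → eqClass R x ≡ A)

{-# OPTIONS --safe #-}
{-# OPTIONS --without-K #-}
-- (i) Transporting the quotient along an equivalence Ω 𝓥 ≃ O with O : 𝓤
-- replaces every class X → Ω 𝓥 by a map X → O, and the (large) equation
-- e_≈(x) = A by the pointwise small one B y ≡ g(e_≈ x y); the truncation
-- keeps the result in 𝓤.
-- (ii) On 𝟐 relate true and false exactly when P holds. The quotient is
-- effective, so P holds iff [true] = [false], iff their images in the small
-- copy of the quotient are equal, and the truncation of that equation is a
-- proposition in 𝓤₀ logically equivalent to P.
module Submission where

open import Defs
open import Level using (Level; zero; Lift; lift)
open import Data.Product using (_×_; Σ; _,_; proj₁; proj₂)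
open import Data.Product.Properties using (Σ-≡,≡→≡)
open import Data.Bool using (Bool; true; false)
open import Data.Unit using (⊤; tt)
open import Function using (_∘_; _⇔_; mk⇔; Equivalence)
open import Relation.Binary.PropositionalEquality hiding ([_])
open import Axiom.UniquenessOfIdentityProofs using (module Constant⇒UIP)

private variable a b c d : Level

isProp⇒UIP : {X : Set a} → isProp X → {x y : X} (p q : x ≡ y) → p ≡ q
isProp⇒UIP {X = X} pr = Constant⇒UIP.≡-irrelevant {A = X} canonical (λ _ _ → refl)
  where
  canonical : {x y : X} → x ≡ y → x ≡ y
  canonical {x} {y} _ = trans (sym (pr x x)) (pr x y)

isProp-isProp : FunExt → {X : Set a} → isProp (isProp X)
isProp-isProp fe p q = fe λ x → fe λ y → isProp⇒UIP p (p x y) (q x y)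

Σ-≡-prop : {A : Set a} {B : A → Set b} → (∀ x → isProp (B x))
         → {u v : Σ A B} → proj₁ u ≡ proj₁ v → u ≡ v
Σ-≡-prop B-prop p = Σ-≡,≡→≡ (p , B-prop _ _ _)

Ω-≡ : FunExt → PropExt → {P Q : Ω a} → (proj₁ P ⇔ proj₁ Q) → P ≡ Q
Ω-≡ fe pe {P = _ , p} {_ , q} P⇔Q =
  Σ-≡-prop (λ _ → isProp-isProp fe) (pe p q (Equivalence.to P⇔Q) (Equivalence.from P⇔Q))

mk≃ : {X : Set a} {Y : Set b} (f : X → Y) (g : Y → X)
    → (∀ y → f (g y) ≡ y) → (∀ x → g (f x) ≡ x) → X ≃ Y
mk≃ f g f∘g g∘f = f , (g , f∘g) , (g , g∘f)

props-⇔⇒≃ : {P : Set a} {Q : Set b} → isProp P → isProp Q → P ⇔ Q → P ≃ Q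
props-⇔⇒≃ p q P⇔Q =
  mk≃ (Equivalence.to P⇔Q) (Equivalence.from P⇔Q) (λ _ → q _ _) (λ _ → p _ _)

module _ {X : Set a} {Y : Set b} (X≃Y : X ≃ Y) where
  private
    f : X → Y
    f = proj₁ X≃Y

  ≃-inverse : Y → X
  ≃-inverse = proj₁ (proj₁ (proj₂ X≃Y))

  ≃-inverseʳ : ∀ y → f (≃-inverse y) ≡ y
  ≃-inverseʳ = proj₂ (proj₁ (proj₂ X≃Y))

  ≃-inverseˡ : ∀ x → ≃-inverse (f x) ≡ x
  ≃-inverseˡ x = begin
    ≃-inverse (f x)         ≡⟨ sym (h∘f (≃-inverse (f x))) ⟩
    h (f (≃-inverse (f x))) ≡⟨ cong h (≃-inverseʳ (f x)) ⟩
    h (f x)                 ≡⟨ h∘f x ⟩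
    x                       ∎
    where
    open ≡-Reasoning
    h : Y → X
    h = proj₁ (proj₂ (proj₂ X≃Y))
    h∘f : ∀ x → h (f x) ≡ x
    h∘f = proj₂ (proj₂ (proj₂ X≃Y))

  ≃-inverse-injective : ∀ {y y′} → ≃-inverse y ≡ ≃-inverse y′ → y ≡ y′
  ≃-inverse-injective {y} {y′} eq =
    trans (sym (≃-inverseʳ y)) (trans (cong f eq) (≃-inverseʳ y′))

Σ-cong-prop : {A : Set a} {A′ : Set b} {B : A → Set c} {B′ : A′ → Set d}
  → (∀ x → isProp (B x)) → (∀ x′ → isProp (B′ x′))
  → (A′≃A : A′ ≃ A) → (∀ x′ → B′ x′ ⇔ B (proj₁ A′≃A x′))
  → Σ A′ B′ ≃ Σ A B
Σ-cong-prop {A = A} {A′} {B} {B′} B-prop B′-prop A′≃A B′⇔B =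
  mk≃ to from
      (λ (x , _) → Σ-≡-prop B-prop (≃-inverseʳ A′≃A x))
      (λ (x′ , _) → Σ-≡-prop B′-prop (≃-inverseˡ A′≃A x′))
  where
  f : A′ → A
  f = proj₁ A′≃A
  to : Σ A′ B′ → Σ A B
  to (x′ , u) = f x′ , Equivalence.to (B′⇔B x′) u
  from : Σ A B → Σ A′ B′
  from (x , v) = ≃-inverse A′≃A x ,
    Equivalence.from (B′⇔B _) (subst B (sym (≃-inverseʳ A′≃A x)) v)

postcompose-≃ : FunExt → {X : Set a} {A : Set b} {A′ : Set c}
              → A′ ≃ A → (X → A′) ≃ (X → A)
postcompose-≃ fe A′≃A@(f , _) =
  mk≃ (λ B x → f (B x)) (λ B x → ≃-inverse A′≃A (B x))
      (λ B → fe λ x → ≃-inverseʳ A′≃A (B x))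
      (λ B → fe λ x → ≃-inverseˡ A′≃A (B x))

module Quotient (pt : PropTrunc) {𝓤 𝓥 : Level} {X : Set 𝓤} (R : EqRel X 𝓥) where
  open PropTrunc pt
  open EqRel R

  [_] : X → X /[ pt ] R
  [ x ] = eqClass R x , ∣ x , refl ∣

  effective : ∀ {x y} → [ x ] ≡ [ y ] → x ≈ y
  effective {x} {y} eq =
    subst proj₁ (sym (cong (λ A → proj₁ A y) eq)) (≈-refl y)

  sound : FunExt → PropExt → ∀ {x y} → x ≈ y → [ x ] ≡ [ y ]
  sound fe pe {x} {y} x≈y = Σ-≡-prop (λ _ → ∥∥-isProp) (fe λ z → Ω-≡ fe pe (mk⇔
    (λ x≈z → ≈-trans y x z (≈-sym x y x≈y) x≈z)
    (λ y≈z → ≈-trans x y z x≈y y≈z)))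

  ≈⇔[]-≡ : FunExt → PropExt → ∀ {x y} → x ≈ y ⇔ ([ x ] ≡ [ y ])
  ≈⇔[]-≡ fe pe = mk⇔ (sound fe pe) effective

  module _ (fe : FunExt) {O : Set 𝓤} (O≃Ω : O ≃ Ω 𝓥) where
    private
      f : O → Ω 𝓥
      f = proj₁ O≃Ω
      g : Ω 𝓥 → O
      g = ≃-inverse O≃Ω

    pointwise-class : (X → O) → Set 𝓤
    pointwise-class B = ∥ Σ X (λ x → ∀ y → B y ≡ g (eqClass R x y)) ∥

    pointwise-class⇔ : ∀ B → pointwise-class B ⇔ ∃∥ pt (λ x → eqClass R x ≡ (λ y → f (B y)))
    pointwise-class⇔ B = mk⇔
      (∥∥-rec ∥∥-isProp λ (x , B≡) → ∣ x , fe (λ y →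
        trans (sym (≃-inverseʳ O≃Ω _)) (cong f (sym (B≡ y)))) ∣)
      (∥∥-rec ∥∥-isProp λ (x , eq) → ∣ x , (λ y →
        trans (sym (≃-inverseˡ O≃Ω (B y))) (cong (λ A → g (A y)) (sym eq))) ∣)

    quotient-small : (X /[ pt ] R) is 𝓤 small
    quotient-small = Σ (X → O) pointwise-class ,
      Σ-cong-prop (λ _ → ∥∥-isProp) (λ _ → ∥∥-isProp) (postcompose-≃ fe O≃Ω) pointwise-class⇔

module _ {𝓥 : Level} (P : Set 𝓥) (P-prop : isProp P) where

  identifiedIf : Bool → Bool → Set 𝓥
  identifiedIf true  true  = Lift 𝓥 ⊤
  identifiedIf false false = Lift 𝓥 ⊤
  identifiedIf true  false = P
  identifiedIf false true  = P

  identifiedIf-eqRel : EqRel Bool 𝓥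
  identifiedIf-eqRel = record
    { _≈_     = identifiedIf
    ; ≈-prop  = λ { true true _ _ → refl ; false false _ _ → refl
                  ; true false → P-prop ; false true → P-prop }
    ; ≈-refl  = λ { true → lift tt ; false → lift tt }
    ; ≈-sym   = λ { true true r → r ; false false r → r
                  ; true false r → r ; false true r → r }
    ; ≈-trans = λ { true true _ _ s → s ; false false _ _ s → s
                  ; true false true _ _ → lift tt ; true false false r _ → r
                  ; false true true r _ → r ; false true false _ _ → lift tt }
    }

prop-small-if-quotients-small : (pt : PropTrunc) → FunExt → PropExt → {𝓥 : Level}
  → ((R : EqRel Bool 𝓥) → (Bool /[ pt ] R) is zero small)
  → (P : Set 𝓥) → isProp P → P is zero small
prop-small-if-quotients-small pt fe pe small P P-prop =
  ∥ φ true ≡ φ false ∥ , props-⇔⇒≃ ∥∥-isProp P-prop (mk⇔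
    (∥∥-rec P-prop (Equivalence.from P⇔classes ∘ ≃-inverse-injective Y≃Q))
    (λ p → ∣ cong (≃-inverse Y≃Q) (Equivalence.to P⇔classes p) ∣))
  where
  open PropTrunc pt
  R : EqRel Bool _
  R = identifiedIf-eqRel P P-prop
  open Quotient pt R
  Y : Set
  Y = proj₁ (small R)
  Y≃Q : Y ≃ (Bool /[ pt ] R)
  Y≃Q = proj₂ (small R)
  φ : Bool → Y
  φ b = ≃-inverse Y≃Q [ b ]
  P⇔classes : P ⇔ ([ true ] ≡ [ false ])
  P⇔classes = ≈⇔[]-≡ fe pe

proposition3p20 : (pt : PropTrunc) → FunExt → PropExt → (𝓤 𝓥 : Level)
    → ((Ω 𝓥 is 𝓤 small)
        → (X : Set 𝓤) (R : EqRel X 𝓥) → (X /[ pt ] R) is 𝓤 small)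
    × (((R : EqRel Bool 𝓥) → (Bool /[ pt ] R) is zero small)
        → (P : Set 𝓥) → isProp P → P is zero small)
proposition3p20 pt fe pe 𝓤 𝓥 =
  (λ (O , O≃Ω) X R → Quotient.quotient-small pt R fe O≃Ω) ,
  prop-small-if-quotients-small pt fe pe
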